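{- Let $k\geq 1$ and $N\geq 4k+1$ be integers and let $P_N$ be the path on $N$ vertices (with loops), where the target moves at most $k$ steps after each test. Then there is no $(P_N,s)$-successful (adaptive) strategy with $s\leq 3k$, i.e. $s^*(P_N)\geq 3k+1$.
   Context: Search model: $G$ is a finite graph on vertex set $\{1,\dots,N\}$ with a loop at every vertex. For $\mathcal A\subseteq\{1,\dots,N\}$, $\Gamma_k(\mathcal A)$ is the set of vertices $j$ such that for some $i\in\mathcal A$ there is a path (walk) from $i$ to $j$ in $G$ of length at most $k$. An unknown target occupies a vertex; a searcher performs tests $\mathcal T_1,\dots,\mathcal T_n\subseteq\{1,\dots,N\}$ one after another; test $i$ returns $y_i=1$ if the target currently lies in $\mathcal T_i$ and $y_i=0$ otherwise; after each test the target moves along a walk of length at most $k$. In an (adaptive) strategy, $\mathcal T_i$ may depend on $y_1,\dots,y_{i-1}$. The sets of possible positions are $\mathcal D_0=\{1,\dots,N\}$ and $\mathcal D_i=\Gamma_k(\mathcal T_i\cap\mathcal D_{i-1})$ if $y_i=1$, $\mathcal D_i=\Gamma_k(\mathcal D_{i-1}\setminus\mathcal T_i)$ if $y_i=0$. A strategy with $n$ tests is $(G,s)$-successful if for every sequence of test results, $|\mathcal D_i|\leq s$ for some $i\in\{0,\dots,n\}$; $s^*(G)$ is the minimum $s$ for which a $(G,s)$-successful strategy with some number of tests exists. The path $P_N$ has vertex set $\{1,\dots,N\}$, edges $\{i-1,i\}$ for $2\leq i\leq N$, and a loop at every vertex. -}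

module Defs where

open import Data.Nat using (ℕ; zero; suc; _≤_)
open import Data.Nat.Properties using (_≟_)
open import Data.Bool using (Bool; true; false; _∧_; _∨_; not; if_then_else_)
open import Data.Fin using (Fin; toℕ)
open import Data.Fin.Subset using (Subset; ∣_∣; _∪_; _∩_; ∁; ⊤)
open import Data.Vec using (Vec; tabulate; zipWith; toList)
open import Data.List using (List; []; _∷_; _++_; take)
open import Data.Bool.ListAction using (or)
open import Data.Product using (∃-syntax; _×_)
open import Relation.Nullary.Decidable using (⌊_⌋)

-- A finite graph on N vertices (vertex i+1 of the paper is Fin element i),
-- given by its (Boolean) adjacency relation; edges i~j allowed to be loops.
Graph : ℕ → Set
Graph N = Fin N → Fin N → Bool

P : (N : ℕ) → Graph N
P N i j = ⌊ toℕ i ≟ toℕ j ⌋ ∨ ⌊ suc (toℕ i) ≟ toℕ j ⌋ ∨ ⌊ suc (toℕ j) ≟ toℕ i ⌋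

Γ₁ : ∀ {N} → Graph N → Subset N → Subset N
Γ₁ G A = tabulate (λ j → or (toList (zipWith _∧_ A (tabulate (λ i → G i j)))))

Γ : ∀ {N} → Graph N → ℕ → Subset N → Subset N
Γ G zero A = A
Γ G (suc k) A = Γ G k A ∪ Γ₁ G (Γ G k A)

-- an adaptive strategy: the next test as a function of the previous results
-- (listed in chronological order)
Strategy : ℕ → Set
Strategy N = List Bool → Subset N

next : ∀ {N} → Graph N → ℕ → Subset N → Subset N → Bool → Subset N
next G k D T true  = Γ G k (T ∩ D)
next G k D T false = Γ G k (D ∩ ∁ T)

run : ∀ {N} → Graph N → ℕ → Strategy N → Subset N → List Bool → List Bool → Subset N
run G k σ D past [] = D
run G k σ D past (y ∷ ys) = run G k σ (next G k D (σ past) y) (past ++ (y ∷ [])) ys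

Dset : ∀ {N} → Graph N → ℕ → Strategy N → List Bool → Subset N
Dset G k σ ys = run G k σ ⊤ [] ys

Successful : ∀ {N} → Graph N → ℕ → Strategy N → ℕ → ℕ → Set
Successful G k σ n s =
  (ys : Vec Bool n) → ∃[ i ] (i ≤ n × ∣ Dset G k σ (take i (toList ys)) ∣ ≤ s)

-- While the possible-positions set D contains one of the intervals [0,3k], [k,4k],
-- it contains the three vertices k, 2k, 3k. Any test puts two of them on the same
-- side; the adversary answers with that side. Two kept vertices at distance at most
-- 2k, after the target moves k steps, again cover [0,3k] or [k,4k], so |D_i| > 3k
-- for every i.
module Submission where

open import Defs
open import Data.Nat using (ℕ; suc; _+_; _*_; _≤_)
open import Relation.Nullary using (¬_)

open import Data.Nat using (zero; _<_; z≤n; s≤s; _≤?_; _≤′_; ≤′-refl; ≤′-step)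
open import Data.Nat.Properties
open import Data.Bool using (Bool; true; false; _∨_)
open import Data.Bool.Properties using (∨-zeroʳ)
open import Data.Bool.ListAction using (or)
open import Data.Fin using (Fin; toℕ; fromℕ<) renaming (zero to fzero; suc to fsuc)
open import Data.Fin.Properties using (toℕ-fromℕ<; toℕ-injective; toℕ<n)
open import Data.Fin.Subset using (Subset; _∈_; _⊆_; ∣_∣; _∩_; ∁; ⊤; inside)
open import Data.Fin.Subset.Properties using (∈⊤; x∈p∩q⁺; x∉p⇒x∈∁p; p⊆p∪q; q⊆p∪q; ∣p∣≤∣x∷p∣; drop-there)
open import Data.Vec using (Vec; []; _∷_; here; there; lookup; tabulate; toList)
open import Data.Vec.Properties using (lookup⇒[]=; []=⇒lookup; lookup∘tabulate)
open import Data.List using (take) renaming ([] to []ᴸ; _∷_ to _∷ᴸ_; _++_ to _++ᴸ_)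
open import Data.Product using (Σ; ∃-syntax; _×_; _,_)
open import Data.Sum using (_⊎_; inj₁; inj₂)
open import Relation.Binary.PropositionalEquality using (_≡_; refl; sym; trans; cong; subst; module ≡-Reasoning)
open import Relation.Nullary using (Dec; yes; no)
open import Relation.Nullary.Decidable using (⌊_⌋; dec-true; isYes≗does)

[_,_]⊆_ : ∀ {n} → ℕ → ℕ → Subset n → Set
[ lo , hi ]⊆ p = ∀ i → lo ≤ toℕ i → toℕ i ≤ hi → i ∈ p

[,]⊆-mono : ∀ {n lo lo′ hi hi′} {p : Subset n} →
  lo ≤ lo′ → hi′ ≤ hi → [ lo , hi ]⊆ p → [ lo′ , hi′ ]⊆ p
[,]⊆-mono lo≤lo′ hi′≤hi ⊆p i lo′≤i i≤hi′ = ⊆p i (≤-trans lo≤lo′ lo′≤i) (≤-trans i≤hi′ hi′≤hi)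

[lo,lo+m]⊆p⇒m<∣p∣ : ∀ {n} lo m (p : Subset n) → lo + m < n → [ lo , lo + m ]⊆ p → m < ∣ p ∣
[lo,lo+m]⊆p⇒m<∣p∣ (suc lo) m (s ∷ p) (s≤s lo+m<n) ⊆p =
  ≤-trans ([lo,lo+m]⊆p⇒m<∣p∣ lo m p lo+m<n λ i lo≤i i≤lo+m →
             drop-there (⊆p (fsuc i) (s≤s lo≤i) (s≤s i≤lo+m)))
          (∣p∣≤∣x∷p∣ s p)
[lo,lo+m]⊆p⇒m<∣p∣ zero m (s ∷ p) (s≤s m<n) ⊆p with ⊆p fzero z≤n z≤n
[lo,lo+m]⊆p⇒m<∣p∣ zero zero    (inside ∷ p) _         _  | here = s≤s z≤n
[lo,lo+m]⊆p⇒m<∣p∣ zero (suc m) (inside ∷ p) (s≤s m<n) ⊆p | here =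
  s≤s ([lo,lo+m]⊆p⇒m<∣p∣ zero m p m<n λ i _ i≤m → drop-there (⊆p (fsuc i) z≤n (s≤s i≤m)))

∈⇒or≡true : ∀ {n} {x : Fin n} {p : Subset n} → x ∈ p → or (toList p) ≡ true
∈⇒or≡true here = refl
∈⇒or≡true {p = s ∷ _} (there x∈p) rewrite ∈⇒or≡true x∈p = ∨-zeroʳ s

∈-tabulate : ∀ {n} {f : Fin n → Bool} {i} → f i ≡ true → i ∈ tabulate f
∈-tabulate {f = f} {i} fi = lookup⇒[]= i (tabulate f) (trans (lookup∘tabulate f i) fi)

module _ {N : ℕ} (G : Graph N) where

  Γ₁-edge : ∀ {A : Subset N} {i j} → i ∈ A → G i j ≡ true → j ∈ Γ₁ G A
  Γ₁-edge i∈A ij = ∈-tabulate (∈⇒or≡true (x∈p∩q⁺ (i∈A , ∈-tabulate ij)))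

  Γ-step : ∀ r {X i j} → i ∈ Γ G r X → G i j ≡ true → j ∈ Γ G (suc r) X
  Γ-step r {X} i∈Γ ij = q⊆p∪q (Γ G r X) (Γ₁ G (Γ G r X)) (Γ₁-edge i∈Γ ij)

  Γ-mono : ∀ {r r′ X} → r ≤′ r′ → Γ G r X ⊆ Γ G r′ X
  Γ-mono ≤′-refl x∈Γ = x∈Γ
  Γ-mono {X = X} (≤′-step {n = r′} r≤′r′) x∈Γ = p⊆p∪q (Γ₁ G (Γ G r′ X)) (Γ-mono r≤′r′ x∈Γ)

⌊⌋≡true : ∀ {A : Set} (a? : Dec A) → A → ⌊ a? ⌋ ≡ true
⌊⌋≡true a? a = trans (isYes≗does a?) (dec-true a? a)

module _ {N : ℕ} where

  P-succ : ∀ (i j : Fin N) → suc (toℕ i) ≡ toℕ j → P N i j ≡ true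
  P-succ i j e = begin
    a ∨ ⌊ suc (toℕ i) ≟ toℕ j ⌋ ∨ c ≡⟨ cong (λ b → a ∨ b ∨ c) (⌊⌋≡true (suc (toℕ i) ≟ toℕ j) e) ⟩
    a ∨ true                         ≡⟨ ∨-zeroʳ a ⟩
    true                             ∎
    where
    open ≡-Reasoning
    a = ⌊ toℕ i ≟ toℕ j ⌋
    c = ⌊ suc (toℕ j) ≟ toℕ i ⌋

  P-pred : ∀ (i j : Fin N) → suc (toℕ j) ≡ toℕ i → P N i j ≡ true
  P-pred i j e = begin
    a ∨ b ∨ ⌊ suc (toℕ j) ≟ toℕ i ⌋ ≡⟨ cong (λ c → a ∨ b ∨ c) (⌊⌋≡true (suc (toℕ j) ≟ toℕ i) e) ⟩
    a ∨ b ∨ true                     ≡⟨ cong (a ∨_) (∨-zeroʳ b) ⟩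
    a ∨ true                         ≡⟨ ∨-zeroʳ a ⟩
    true                             ∎
    where
    open ≡-Reasoning
    a = ⌊ toℕ i ≟ toℕ j ⌋
    b = ⌊ suc (toℕ i) ≟ toℕ j ⌋

  Γ-P-rightward : ∀ d {X} {x j : Fin N} → x ∈ X → toℕ x + d ≡ toℕ j → j ∈ Γ (P N) d X
  Γ-P-rightward zero {X} {x} x∈X e =
    subst (_∈ X) (toℕ-injective (trans (sym (+-identityʳ (toℕ x))) e)) x∈X
  Γ-P-rightward (suc d) {x = x} {j} x∈X e =
    Γ-step (P N) d (Γ-P-rightward d x∈X (sym (toℕ-fromℕ< x+d<N)))
                   (P-succ _ j (trans (cong suc (toℕ-fromℕ< x+d<N)) 1+x+d≡j))
    where
    1+x+d≡j : suc (toℕ x + d) ≡ toℕ j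
    1+x+d≡j = trans (sym (+-suc (toℕ x) d)) e
    x+d<N : toℕ x + d < N
    x+d<N = ≤-trans (≤-reflexive 1+x+d≡j) (<⇒≤ (toℕ<n j))

  Γ-P-leftward : ∀ d {X} {x j : Fin N} → x ∈ X → toℕ j + d ≡ toℕ x → j ∈ Γ (P N) d X
  Γ-P-leftward zero {X} {x} {j} x∈X e =
    subst (_∈ X) (toℕ-injective (trans (sym e) (+-identityʳ (toℕ j)))) x∈X
  Γ-P-leftward (suc d) {x = x} {j} x∈X e =
    Γ-step (P N) d (Γ-P-leftward d x∈X (trans (cong (_+ d) (toℕ-fromℕ< 1+j<N)) 1+j+d≡x))
                   (P-pred _ j (sym (toℕ-fromℕ< 1+j<N)))
    where
    1+j+d≡x : suc (toℕ j) + d ≡ toℕ x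
    1+j+d≡x = trans (sym (+-suc (toℕ j) d)) e
    1+j<N : suc (toℕ j) < N
    1+j<N = ≤-<-trans (≤-trans (m≤m+n (suc (toℕ j)) d) (≤-reflexive 1+j+d≡x)) (toℕ<n x)

  Γ-P-ball : ∀ {r X} {x j : Fin N} → x ∈ X →
    toℕ j ≤ toℕ x + r → toℕ x ≤ toℕ j + r → j ∈ Γ (P N) r X
  Γ-P-ball {r} {x = x} {j} x∈X j≤x+r x≤j+r with ≤-total (toℕ x) (toℕ j)
  ... | inj₁ x≤j = Γ-mono (P N) (≤⇒≤′ (m≤n+o⇒m∸n≤o (toℕ j) (toℕ x) j≤x+r))
                           (Γ-P-rightward _ x∈X (m+[n∸m]≡n x≤j))
  ... | inj₂ j≤x = Γ-mono (P N) (≤⇒≤′ (m≤n+o⇒m∸n≤o (toℕ x) (toℕ j) x≤j+r))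
                           (Γ-P-leftward _ x∈X (m+[n∸m]≡n j≤x))

  Γ-P-pair : ∀ {k lo hi X} {x y : Fin N} → x ∈ X → y ∈ X →
    toℕ x ≤ lo + k → toℕ y ≤ toℕ x + 2 * k → hi ≤ toℕ y + k → [ lo , hi ]⊆ Γ (P N) k X
  Γ-P-pair {k} {x = x} {y} x∈X y∈X x≤lo+k y≤x+2k hi≤y+k j lo≤j j≤hi with toℕ j ≤? toℕ x + k
  ... | yes j≤x+k = Γ-P-ball x∈X j≤x+k (≤-trans x≤lo+k (+-monoˡ-≤ k lo≤j))
  ... | no  j≰x+k = Γ-P-ball y∈X (≤-trans j≤hi hi≤y+k) (begin
    toℕ y             ≤⟨ y≤x+2k ⟩
    toℕ x + 2 * k     ≡⟨ cong (toℕ x +_) (cong (k +_) (+-identityʳ k)) ⟩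
    toℕ x + (k + k)   ≡⟨ +-assoc (toℕ x) k k ⟨
    toℕ x + k + k     ≤⟨ +-monoˡ-≤ k (<⇒≤ (≰⇒> j≰x+k)) ⟩
    toℕ j + k         ∎)
    where open ≤-Reasoning

consistent : ∀ {N} → Subset N → Subset N → Bool → Subset N
consistent T D true  = T ∩ D
consistent T D false = D ∩ ∁ T

next≡Γ-consistent : ∀ {N} (G : Graph N) k D T y → next G k D T y ≡ Γ G k (consistent T D y)
next≡Γ-consistent G k D T true  = refl
next≡Γ-consistent G k D T false = refl

∈-consistent : ∀ {N} (T : Subset N) {D x y} → x ∈ D → lookup T x ≡ y → x ∈ consistent T D y
∈-consistent T {x = x} {true}  x∈D Tx = x∈p∩q⁺ (lookup⇒[]= x T Tx , x∈D)
∈-consistent T {x = x} {false} x∈D Tx = x∈p∩q⁺ (x∈D , x∉p⇒x∈∁p x∉T)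
  where x∉T : ¬ x ∈ T
        x∉T x∈T with () ← trans (sym ([]=⇒lookup x∈T)) Tx

Γ-P-same-side : ∀ {N k lo hi a b} {D : Subset N} (T : Subset N) {x y : Fin N} →
  x ∈ D → y ∈ D → lookup T x ≡ lookup T y → toℕ x ≡ a → toℕ y ≡ b →
  a ≤ lo + k → b ≤ a + 2 * k → hi ≤ b + k → [ lo , hi ]⊆ next (P N) k D T (lookup T x)
Γ-P-same-side {N} {k} {D = D} T {x} x∈D y∈D Tx≡Ty refl refl a≤ b≤ hi≤
  rewrite next≡Γ-consistent (P N) k D T (lookup T x) =
  Γ-P-pair (∈-consistent T x∈D refl) (∈-consistent T y∈D (sym Tx≡Ty)) a≤ b≤ hi≤

pigeonhole : ∀ (a b c : Bool) → a ≡ b ⊎ b ≡ c ⊎ a ≡ c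
pigeonhole false false _     = inj₁ refl
pigeonhole true  true  _     = inj₁ refl
pigeonhole false true  true  = inj₂ (inj₁ refl)
pigeonhole true  false false = inj₂ (inj₁ refl)
pigeonhole false true  false = inj₂ (inj₂ refl)
pigeonhole true  false true  = inj₂ (inj₂ refl)

Good : ∀ {N} → ℕ → Subset N → Set
Good k D = [ 0 , 3 * k ]⊆ D ⊎ [ k , 4 * k ]⊆ D

Good-⊤ : ∀ {N} k → Good {N} k ⊤
Good-⊤ k = inj₁ λ _ _ _ → ∈⊤

module _ {N k : ℕ} (4k<N : 4 * k < N) where

  Good⇒3k<∣D∣ : ∀ {D : Subset N} → Good k D → 3 * k < ∣ D ∣
  Good⇒3k<∣D∣ {D} (inj₁ ⊆D) = [lo,lo+m]⊆p⇒m<∣p∣ 0 (3 * k) D (≤-<-trans (m≤n+m (3 * k) k) 4k<N) ⊆D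
  Good⇒3k<∣D∣ {D} (inj₂ ⊆D) = [lo,lo+m]⊆p⇒m<∣p∣ k (3 * k) D 4k<N ⊆D

  Good⇒[k,3k]⊆ : ∀ {D : Subset N} → Good k D → [ k , 3 * k ]⊆ D
  Good⇒[k,3k]⊆ (inj₁ ⊆D) = [,]⊆-mono z≤n ≤-refl ⊆D
  Good⇒[k,3k]⊆ (inj₂ ⊆D) = [,]⊆-mono ≤-refl (m≤n+m (3 * k) k) ⊆D

  vertex : ∀ {D : Subset N} → [ k , 3 * k ]⊆ D → ∀ m → k ≤ m → m ≤ 3 * k → ∃[ x ] toℕ x ≡ m × x ∈ D
  vertex ⊆D m k≤m m≤3k =
    x , x≡m , ⊆D x (subst (k ≤_) (sym x≡m) k≤m) (subst (_≤ 3 * k) (sym x≡m) m≤3k)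
    where
    m<N : m < N
    m<N = ≤-<-trans (≤-trans m≤3k (m≤n+m (3 * k) k)) 4k<N
    x = fromℕ< m<N
    x≡m : toℕ x ≡ m
    x≡m = toℕ-fromℕ< m<N

  Good-preserved : ∀ {D : Subset N} (T : Subset N) → Good k D → ∃[ y ] Good k (next (P N) k D T y)
  Good-preserved T g
    with vertex (Good⇒[k,3k]⊆ g) k ≤-refl (m≤m+n k (2 * k))
       | vertex (Good⇒[k,3k]⊆ g) (2 * k) (m≤m+n k (1 * k)) (m≤n+m (2 * k) k)
       | vertex (Good⇒[k,3k]⊆ g) (3 * k) (m≤m+n k (2 * k)) ≤-refl
  ... | a , a≡k , a∈D | b , b≡2k , b∈D | c , c≡3k , c∈D
    with pigeonhole (lookup T a) (lookup T b) (lookup T c)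
  ... | inj₁ Ta≡Tb = lookup T a , inj₁ (Γ-P-same-side T a∈D b∈D Ta≡Tb a≡k b≡2k
          ≤-refl (m≤n+m (2 * k) k) (≤-reflexive (+-comm k (2 * k))))
  ... | inj₂ (inj₁ Tb≡Tc) = lookup T b , inj₂ (Γ-P-same-side T b∈D c∈D Tb≡Tc b≡2k c≡3k
          (≤-reflexive (cong (k +_) (*-identityˡ k))) (+-monoˡ-≤ (2 * k) (m≤m+n k (1 * k)))
          (≤-reflexive (+-comm k (3 * k))))
  ... | inj₂ (inj₂ Ta≡Tc) = lookup T a , inj₁ (Γ-P-same-side T a∈D c∈D Ta≡Tc a≡k c≡3k
          ≤-refl ≤-refl (m≤m+n (3 * k) k))

module _ {N : ℕ} (G : Graph N) (k : ℕ) (σ : Strategy N) (Inv : Subset N → Set)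
         (preserved : ∀ {D} (T : Subset N) → Inv D → ∃[ y ] Inv (next G k D T y)) where

  adversary : ∀ n past D → Inv D →
    Σ (Vec Bool n) λ ys → ∀ i → Inv (run G k σ D past (take i (toList ys)))
  adversary zero    past D inv = [] , λ { zero → inv ; (suc i) → inv }
  adversary (suc n) past D inv with preserved (σ past) inv
  ... | y , inv′ with adversary n (past ++ᴸ (y ∷ᴸ []ᴸ)) (next G k D (σ past) y) inv′
  ... | ys , invs = y ∷ ys , λ { zero → inv ; (suc i) → invs i }

  invariant⇒¬Successful : ∀ {s} → Inv ⊤ → (∀ {D} → Inv D → s < ∣ D ∣) →
    ∀ n → ¬ Successful G k σ n s
  invariant⇒¬Successful inv⊤ large n successful with adversary n []ᴸ ⊤ inv⊤
  ... | ys , invs with successful ys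
  ... | i , _ , ∣Dᵢ∣≤s = <⇒≱ (large (invs i)) ∣Dᵢ∣≤s

proposition2 : (k N : ℕ) → 1 ≤ k → 4 * k + 1 ≤ N →
    (s : ℕ) → s ≤ 3 * k → (n : ℕ) → (σ : Strategy N) →
    ¬ Successful (P N) k σ n s
proposition2 k N _ 4k+1≤N s s≤3k n σ =
  invariant⇒¬Successful (P N) k σ (Good k) (Good-preserved 4k<N) (Good-⊤ k)
    (λ good → ≤-<-trans s≤3k (Good⇒3k<∣D∣ 4k<N good)) n
  where
  4k<N : 4 * k < N
  4k<N = subst (_≤ N) (+-comm (4 * k) 1) 4k+1≤N
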